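{- Let $n_1,n_2\ge1$ be integers with $n_2\mid n_1$, let $\lambda\in\{1,-1\}$, and let $\sigma:I_{n_1}\to I_{n_2}$ be the reduction map. (1) If $(\psi^1_i)_{i\in I_{n_1}}$ solves the Lewis system in $\mathcal R$ for $n=n_1$, then $(\psi^2_j)_{j\in I_{n_2}}$ with $$\psi^2_j:=\sum_{i\in\sigma^{ -1}(j)}\psi^1_i$$ solves it for $n=n_2$. (2) Conversely, if $(\psi^2_j)_{j\in I_{n_2}}$ solves the system for $n=n_2$, then $(\psi^1_i)_{i\in I_{n_1}}$ with $\psi^1_i:=\psi^2_{\sigma(i)}$ solves it for $n=n_1$.
   Context: Matrices: $I=\begin{pmatrix}1&0\\0&1\end{pmatrix}$, $T=\begin{pmatrix}1&1\\0&1\end{pmatrix}$, $M=\begin{pmatrix}0&1\\1&0\end{pmatrix}$. Classes and $I_n$. For $n\ge1$ and $(x,y),(x',y')\in\mathbb Z^2$ write $(x,y)\sim_n(x',y')$ if there is $k$ with $\gcd(k,n)=1$, $kx\equiv x'$ and $ky\equiv y'\pmod n$; $[x:y]_n$ is the class. $\mathrm{GL}(2,\mathbb Z)$ acts from the right by $[x:y]_n\begin{pmatrix}a&b\\c&d\end{pmatrix}=[ax+cy:bx+dy]_n$. $I_n$ is the orbit of $[0:1]_n$, i.e. the classes of bottom rows of matrices in $\mathrm{GL}(2,\mathbb Z)$; it is identified with $\overline\Gamma_0(n)\backslash\mathrm{GL}(2,\mathbb Z)$. Reduction map. For $n_2\mid n_1$, $\sigma([x:y]_{n_1})=[x:y]_{n_2}$.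 The ring $\mathcal R$. Finite formal $\mathbb Z$-combinations of integer $2\times2$ matrices of nonzero determinant, with bilinearly extended multiplication. $\mathcal I^\lambda=(I-T-\lambda TM)\mathcal R$ is a right ideal. Lewis system in $\mathcal R$. A family $(\psi_i)_{i\in I_n}$ of elements of $\mathcal R$ solves it for $n$ if $$\psi_i-\psi_{iT^{ -1}}T-\lambda\psi_{iT^{ -1}M}TM\in\mathcal I^\lambda\qquad\text{for all } i\in I_n .$$ Equivalently, $$\psi_{[c:d]}-\psi_{[c:d-c]}T-\lambda\psi_{[d-c:c]}TM\in\mathcal I^\lambda\qquad\text{for all } [c:d]\in I_n .$$ -}

module Defs where

open import Data.Nat as ℕ using (ℕ)
open import Data.Integer
open import Data.Integer.Properties using (_≟_; i*j≡0⇒i≡0∨j≡0)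
open import Data.Integer.Divisibility using () renaming (_∣_ to _∣ℤ_)
open import Data.Integer.Coprimality using (Coprime)
open import Data.Integer.Solver using (module +-*-Solver)
open import Data.Product using (Σ; ∃; _×_; _,_; proj₁; proj₂)
open import Data.Sum using (_⊎_; inj₁; inj₂)
open import Data.List using (List; []; _∷_; _++_; map; concatMap; foldr)
open import Data.List.Relation.Unary.All using (All)
open import Data.List.Relation.Unary.Any using (Any)
open import Data.List.Relation.Unary.AllPairs using (AllPairs)
open import Data.Bool using (Bool; true; false; if_then_else_; _∧_)
open import Relation.Nullary using (¬_; does)
open import Relation.Binary.PropositionalEquality using (_≡_; refl; cong; sym; trans)

det : ℤ → ℤ → ℤ → ℤ → ℤ
det a b c d = a * d - b * c

record Mat : Set where
  constructor mat
  field
    a b c d : ℤ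
    det≢0 : ¬ (det a b c d ≡ 0ℤ)
open Mat

private
  det-mul : ∀ a b c d a' b' c' d' →
    det (a * a' + b * c') (a * b' + b * d') (c * a' + d * c') (c * b' + d * d')
      ≡ det a b c d * det a' b' c' d'
  det-mul = +-*-Solver.solve 8
    (λ a b c d a' b' c' d' →
       (a :* a' :+ b :* c') :* (c :* b' :+ d :* d')
         :- (a :* b' :+ b :* d') :* (c :* a' :+ d :* c')
       := (a :* d :- b :* c) :* (a' :* d' :- b' :* c')) refl
    where open +-*-Solver

  nz-mul : ∀ x y → ¬ (x ≡ 0ℤ) → ¬ (y ≡ 0ℤ) → ¬ (x * y ≡ 0ℤ)
  nz-mul x y x≢0 y≢0 p with i*j≡0⇒i≡0∨j≡0 x p
  ... | inj₁ q = x≢0 q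
  ... | inj₂ q = y≢0 q

_·_ : Mat → Mat → Mat
mat a b c d p · mat a' b' c' d' p' =
  mat (a * a' + b * c') (a * b' + b * d') (c * a' + d * c') (c * b' + d * d')
      (λ e → nz-mul (det a b c d) (det a' b' c' d') p p'
               (trans (sym (det-mul a b c d a' b' c' d')) e))

matI matT matM : Mat
matI = mat 1ℤ 0ℤ 0ℤ 1ℤ (λ ())
matT = mat 1ℤ 1ℤ 0ℤ 1ℤ (λ ())
matM = mat 0ℤ 1ℤ 1ℤ 0ℤ (λ ())

_==M_ : Mat → Mat → Bool
A ==M B = does (a A ≟ a B) ∧ does (b A ≟ b B) ∧ does (c A ≟ c B) ∧ does (d A ≟ d B)

-- The ring R: finite formal ℤ-combinations of matrices, represented by
-- lists of (coefficient, matrix) terms; two lists represent the same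
-- element iff every matrix gets the same total coefficient.

R : Set
R = List (ℤ × Mat)

coeff : R → Mat → ℤ
coeff [] g = 0ℤ
coeff ((k , A) ∷ xs) g = (if A ==M g then k else 0ℤ) + coeff xs g

infix 4 _≈R_
_≈R_ : R → R → Set
x ≈R y = ∀ g → coeff x g ≡ coeff y g

[_] : Mat → R
[ A ] = (1ℤ , A) ∷ []

_+R_ : R → R → R
x +R y = x ++ y

_⋆_ : ℤ → R → R
k ⋆ x = map (λ t → k * proj₁ t , proj₂ t) x

-R_ : R → R
-R x = (-1ℤ) ⋆ x

_-R_ : R → R → R
x -R y = x +R (-R y)

_*R_ : R → R → R
x *R y = concatMap (λ s → map (λ t → proj₁ s * proj₁ t , proj₂ s · proj₂ t) y) x

0R : R
0R = []

sumR : List R → R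
sumR = foldr _+R_ 0R

gen : ℤ → R
gen lam = ([ matI ] -R [ matT ]) -R (lam ⋆ [ matT · matM ])

InIdeal : ℤ → R → Set
InIdeal lam x = Σ R λ r → x ≈R (gen lam *R r)

-- Classes [x:y]_n, represented by pairs of integers

Pair : Set
Pair = ℤ × ℤ

Equiv : ℕ → Pair → Pair → Set
Equiv n (x , y) (x' , y') =
  Σ ℤ λ k → Coprime k (+ n) × ((+ n) ∣ℤ (k * x - x')) × ((+ n) ∣ℤ (k * y - y'))

IsGL2Z : Mat → Set
IsGL2Z A = det (a A) (b A) (c A) (d A) ≡ 1ℤ ⊎ det (a A) (b A) (c A) (d A) ≡ -1ℤ

act : Pair → Mat → Pair
act (x , y) A = (a A * x + c A * y , b A * x + d A * y)

InI : ℕ → Pair → Set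
InI n i = Σ Mat λ g → IsGL2Z g × Equiv n (act (0ℤ , 1ℤ) g) i

-- a family indexed by I_n, given on representatives, is well defined
Respects : ℕ → (Pair → R) → Set
Respects n ψ = ∀ i i' → InI n i → Equiv n i i' → ψ i ≈R ψ i'

Solves : ℕ → ℤ → (Pair → R) → Set
Solves n lam ψ = ∀ c d → InI n (c , d) →
  InIdeal lam ((ψ (c , d) -R (ψ (c , d - c) *R [ matT ]))
                 -R (lam ⋆ (ψ (d - c , c) *R [ matT · matM ])))

-- reduction map σ : I_{n₁} → I_{n₂} on representatives
σ : Pair → Pair
σ i = i

-- L is a system of representatives of the fibre σ⁻¹([j]_{n₂}) ⊆ I_{n₁}:
-- its members lie in the fibre, are pairwise distinct classes mod n₁,
-- and every class in the fibre is represented.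
FibreTransversal : ℕ → ℕ → Pair → List Pair → Set
FibreTransversal n₁ n₂ j L =
  All (λ i → InI n₁ i × Equiv n₂ (σ i) j) L ×
  AllPairs (λ i i' → ¬ Equiv n₁ i i') L ×
  (∀ i → InI n₁ i → Equiv n₂ (σ i) j → Any (Equiv n₁ i) L)

-- Right multiplication by T⁻¹ and by T⁻¹M permutes the classes modulo n₁ and commutes with
-- reduction modulo n₂, so it maps the fibre of the reduction map over j bijectively onto the
-- fibre over jT⁻¹ (resp. jT⁻¹M). A sum over a system of representatives of a fibre does not
-- depend on the chosen representatives, hence the Lewis expression of ψ² at j is the sum of
-- the Lewis expressions of ψ¹ over the fibre of j, which lies in the right ideal I^λ.
-- Conversely ∼_{n₁} refines ∼_{n₂} and I_{n₁} reduces into I_{n₂}, so every equation of the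
-- pulled-back system is one of the equations for n₂.
module Submission where

open import Level using (Level; 0ℓ)
open import Algebra.Bundles using (CommutativeMonoid)
open import Data.Bool using (true; false; if_then_else_)
open import Data.Integer using (ℤ; +_; _*_; _+_; _-_; -_; 0ℤ; 1ℤ; -1ℤ; ∣_∣; _≟_)
import Data.Integer.Properties as ℤ
open import Data.Integer.Coprimality using (Coprime)
open import Data.Integer.Divisibility.Signed as ℤ∣ using (divides) renaming (_∣_ to _∣ℤ_)
open import Data.Integer.Tactic.RingSolver using (solve-∀)
open import Data.Empty using (⊥-elim)
open import Data.List using (List; []; _∷_; _++_; map; foldr)
import Data.List.Properties as List
open import Data.List.Relation.Unary.All as All using (All; []; _∷_)
import Data.List.Relation.Unary.All.Properties as All
open import Data.List.Relation.Unary.Any as Any using (Any; here; there; _─_)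
import Data.List.Relation.Unary.Any.Properties as Any
open import Data.List.Relation.Unary.AllPairs as AllPairs using (AllPairs; []; _∷_)
import Data.List.Relation.Unary.AllPairs.Properties as AllPairs
open import Data.Nat as ℕ using (ℕ; _≤_)
open import Data.Nat.Coprimality using (coprime-Bézout)
open import Data.Nat.Divisibility as ℕ∣ using (_∣_)
open import Data.Nat.GCD using (module Bézout)
open import Data.Product using (∃; _×_; _,_; proj₁; proj₂)
open import Data.Sum using (_⊎_; inj₁; inj₂)
open import Function using (_∘_; _⇔_; mk⇔; Equivalence)
open import Relation.Binary using (Rel; Setoid; IsEquivalence; Symmetric)
open import Relation.Binary.PropositionalEquality
  using (_≡_; refl; sym; trans; cong; cong₂; subst; subst₂; module ≡-Reasoning)
open import Relation.Nullary using (¬_)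
open import Relation.Nullary.Decidable using (Dec; proof; map′; _×-dec_)
import Relation.Nullary.Reflects as Reflects
open import Relation.Unary using (Pred)
import Relation.Binary.Reasoning.Setoid

open import Defs

private
  variable
    a p q r : Level
    A : Set a

Any-─ : {P : Pred A p} {Q : Pred A q} {xs : List A} (i : Any P xs) →
  Any Q xs → ¬ Q (Any.lookup i) → Any Q (xs ─ i)
Any-─ (here _)  (here q)  ¬q = ⊥-elim (¬q q)
Any-─ (here _)  (there q) _  = q
Any-─ (there _) (here q)  _  = here q
Any-─ (there i) (there q) ¬q = there (Any-─ i q ¬q)

AllPairs-─ : {P : Pred A p} {R : Rel A r} {xs : List A} (i : Any P xs) →
  AllPairs R xs → AllPairs R (xs ─ i)
AllPairs-─ (here _)  (_ ∷ rs)  = rs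
AllPairs-─ (there i) (r ∷ rs) = All.─⁺ i r ∷ AllPairs-─ i rs

AllPairs-lookup-─ : {P : Pred A p} {R : Rel A r} {xs : List A} → Symmetric R →
  (i : Any P xs) → AllPairs R xs → All (R (Any.lookup i)) (xs ─ i)
AllPairs-lookup-─ _   (here _)  (r ∷ _)  = r
AllPairs-lookup-─ sym (there i) (r ∷ rs) =
  sym (proj₁ (All.lookupAny r i)) ∷ AllPairs-lookup-─ sym i rs

module _ {c ℓ} (M : CommutativeMonoid c ℓ) where
  open CommutativeMonoid M renaming (refl to ≈-refl; sym to ≈-sym)
  open import Algebra.Properties.CommutativeSemigroup commutativeSemigroup
    using (interchange; x∙yz≈y∙xz)
  open import Relation.Binary.Reasoning.Setoid setoid

  sum : List Carrier → Carrier
  sum = foldr _∙_ ε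

  sum-map-─ : {P : Pred A p} (f : A → Carrier) {xs : List A} (i : Any P xs) →
    sum (map f xs) ≈ f (Any.lookup i) ∙ sum (map f (xs ─ i))
  sum-map-─ f (here _) = ≈-refl
  sum-map-─ f {x ∷ xs} (there i) = begin
    f x ∙ sum (map f xs)                             ≈⟨ ∙-congˡ (sum-map-─ f i) ⟩
    f x ∙ (f (Any.lookup i) ∙ sum (map f (xs ─ i)))  ≈⟨ x∙yz≈y∙xz _ _ _ ⟩
    f (Any.lookup i) ∙ (f x ∙ sum (map f (xs ─ i)))  ∎

  sum-map-∙ : (f g : A → Carrier) (xs : List A) →
    sum (map (λ x → f x ∙ g x) xs) ≈ sum (map f xs) ∙ sum (map g xs)
  sum-map-∙ f g [] = ≈-sym (identityˡ ε)
  sum-map-∙ f g (x ∷ xs) = begin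
    (f x ∙ g x) ∙ sum (map (λ x → f x ∙ g x) xs)        ≈⟨ ∙-congˡ (sum-map-∙ f g xs) ⟩
    (f x ∙ g x) ∙ (sum (map f xs) ∙ sum (map g xs))     ≈⟨ interchange _ _ _ _ ⟩
    (f x ∙ sum (map f xs)) ∙ (g x ∙ sum (map g xs))     ∎

  sum-map-homomorphic : (h : Carrier → Carrier) → h ε ≈ ε → (∀ x y → h (x ∙ y) ≈ h x ∙ h y) →
    (f : A → Carrier) (xs : List A) → sum (map (λ x → h (f x)) xs) ≈ h (sum (map f xs))
  sum-map-homomorphic h h-ε h-∙ f [] = ≈-sym h-ε
  sum-map-homomorphic h h-ε h-∙ f (x ∷ xs) = begin
    h (f x) ∙ sum (map (λ x → h (f x)) xs)  ≈⟨ ∙-congˡ (sum-map-homomorphic h h-ε h-∙ f xs) ⟩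
    h (f x) ∙ h (sum (map f xs))            ≈⟨ h-∙ _ _ ⟨
    h (f x ∙ sum (map f xs))                ∎

  module _ {s e} (S : Setoid s e) where
    open Setoid S using () renaming (Carrier to Point; _≈_ to _∼_; sym to ∼-sym; trans to ∼-trans)
    open import Data.List.Membership.Setoid S using (_∈_)
    open import Data.List.Relation.Unary.Unique.Setoid S using (Unique)

    sum-transversal : (Ok : Pred Point p) (f : Point → Carrier) →
      (∀ {x y} → Ok x → x ∼ y → f x ≈ f y) →
      (xs ys : List Point) → All Ok xs → Unique xs → Unique ys →
      All (_∈ ys) xs → All (_∈ xs) ys → sum (map f xs) ≈ sum (map f ys)
    sum-transversal Ok f f-resp [] [] _ _ _ _ _ = ≈-refl
    sum-transversal Ok f f-resp [] (_ ∷ _) _ _ _ _ (() ∷ _)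
    sum-transversal Ok f f-resp (x ∷ xs) ys
      (ok ∷ oks) (x≁xs ∷ xs-unique) ys-unique (x∈ys ∷ xs⊆ys) ys⊆x∷xs = begin
        f x ∙ sum (map f xs)
          ≈⟨ ∙-cong (f-resp ok x∼y) (sum-transversal Ok f f-resp xs (ys ─ x∈ys)
                                       oks xs-unique (AllPairs-─ x∈ys ys-unique) xs⊆ys′ ys′⊆xs) ⟩
        f y ∙ sum (map f (ys ─ x∈ys))
          ≈⟨ sum-map-─ f x∈ys ⟨
        sum (map f ys)
          ∎
      where
      y : Point
      y = Any.lookup x∈ys
      x∼y : x ∼ y
      x∼y = Any.lookup-result x∈ys
      xs⊆ys′ : All (_∈ (ys ─ x∈ys)) xs
      xs⊆ys′ = All.zipWith
        (λ (x≁x′ , x′∈ys) → Any-─ x∈ys x′∈ys λ x′∼y → x≁x′ (∼-trans x∼y (∼-sym x′∼y)))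
        (x≁xs , xs⊆ys)
      ys′⊆xs : All (_∈ xs) (ys ─ x∈ys)
      ys′⊆xs = All.zipWith
        (λ { (y≁y′ , here y′∼x) → ⊥-elim (y≁y′ (∼-sym (∼-trans y′∼x x∼y)))
           ; (_ , there y′∈xs) → y′∈xs })
        (AllPairs-lookup-─ (λ ≁ ∼ → ≁ (∼-sym ∼)) x∈ys ys-unique , All.─⁺ x∈ys ys⊆x∷xs)

UnitMod : ℕ → ℤ → Set
UnitMod n k = ∃ λ u → + n ∣ℤ u * k - 1ℤ

∣-combination : ∀ {m a b z} α β → z ≡ α * a + β * b → m ∣ℤ a → m ∣ℤ b → m ∣ℤ z
∣-combination α β refl m∣a m∣b = ℤ∣.∣m∣n⇒∣m+n (ℤ∣.∣n⇒∣m*n α m∣a) (ℤ∣.∣n⇒∣m*n β m∣b)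

unitMod⇒coprime : ∀ {n k} → UnitMod n k → Coprime k (+ n)
unitMod⇒coprime {n} {k} (u , n∣uk-1) {i} (i∣k , i∣n) =
  ℕ∣.∣1⇒≡1 (ℤ∣.∣⇒∣ᵤ (∣-combination u -1ℤ (one≡ u k) (ℤ∣.∣ᵤ⇒∣ {+ i} {k} i∣k)
    (ℤ∣.∣-trans (ℤ∣.∣ᵤ⇒∣ {+ i} {+ n} i∣n) n∣uk-1)))
  where
  one≡ : ∀ u k → 1ℤ ≡ u * k + -1ℤ * (u * k - 1ℤ)
  one≡ = solve-∀

pos-1+*≡* : ∀ a b c d → 1 ℕ.+ a ℕ.* b ≡ c ℕ.* d → 1ℤ + + a * + b ≡ + c * + d
pos-1+*≡* a b c d eq = begin
  1ℤ + + a * + b      ≡⟨ cong (λ z → 1ℤ + z) (ℤ.pos-* a b) ⟨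
  1ℤ + + (a ℕ.* b)    ≡⟨ ℤ.pos-+ 1 (a ℕ.* b) ⟨
  + (1 ℕ.+ a ℕ.* b)   ≡⟨ cong +_ eq ⟩
  + (c ℕ.* d)         ≡⟨ ℤ.pos-* c d ⟩
  + c * + d           ∎
  where open ≡-Reasoning

bézout⇒unitMod : ∀ {m n} → Bézout.Identity 1 m n → UnitMod n (+ m)
bézout⇒unitMod {m} {n} (Bézout.+- x y eq) =
  + x , divides (+ y) (trans (cong (_- 1ℤ) (sym (pos-1+*≡* y n x m eq))) (cancel (+ y * + n)))
  where
  cancel : ∀ b → 1ℤ + b - 1ℤ ≡ b
  cancel = solve-∀
bézout⇒unitMod {m} {n} (Bézout.-+ x y eq) =
  - (+ x) , divides (- (+ y)) (begin
    (- (+ x)) * + m - 1ℤ   ≡⟨ negate (+ x) (+ m) ⟩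
    - (1ℤ + + x * + m)     ≡⟨ cong -_ (pos-1+*≡* x m y n eq) ⟩
    - (+ y * + n)          ≡⟨ ℤ.neg-distribˡ-* (+ y) (+ n) ⟩
    (- (+ y)) * + n        ∎)
  where
  open ≡-Reasoning
  negate : ∀ x m → (- x) * m - 1ℤ ≡ - (1ℤ + x * m)
  negate = solve-∀

unitMod-∣∣ : ∀ {n k} → UnitMod n (+ ∣ k ∣) → UnitMod n k
unitMod-∣∣ {n} {k} (u , n∣) with ℤ.+∣i∣≡i⊎+∣i∣≡-i k
... | inj₁ ∣k∣≡k  = u , subst (λ k → + n ∣ℤ u * k - 1ℤ) ∣k∣≡k n∣
... | inj₂ ∣k∣≡-k = - u , subst (λ z → + n ∣ℤ z - 1ℤ) (trans (cong (u *_) ∣k∣≡-k) (neg-swap u k)) n∣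
  where
  neg-swap : ∀ u k → u * (- k) ≡ (- u) * k
  neg-swap = solve-∀

coprime⇒unitMod : ∀ {n k} → Coprime k (+ n) → UnitMod n k
coprime⇒unitMod c = unitMod-∣∣ (bézout⇒unitMod (coprime-Bézout c))

-- ∼ₙ with an explicit inverse of k modulo n in place of coprimality, and signed divisibility:
-- in this form symmetry, transitivity and the action of matrices reduce to ring identities.
Equivˢ : ℕ → Pair → Pair → Set
Equivˢ n (x , y) (x' , y') =
  ∃ λ k → UnitMod n k × + n ∣ℤ k * x - x' × + n ∣ℤ k * y - y'

Equiv⇒Equivˢ : ∀ {n} p q → Equiv n p q → Equivˢ n p q
Equiv⇒Equivˢ {n} (x , y) (x' , y') (k , k⊥n , n∣x , n∣y) =
  k , coprime⇒unitMod k⊥n , ℤ∣.∣ᵤ⇒∣ {+ n} {k * x - x'} n∣x , ℤ∣.∣ᵤ⇒∣ {+ n} {k * y - y'} n∣y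

Equivˢ⇒Equiv : ∀ {n} p q → Equivˢ n p q → Equiv n p q
Equivˢ⇒Equiv (x , y) (x' , y') (k , k-unit , n∣x , n∣y) =
  k , unitMod⇒coprime k-unit , ℤ∣.∣⇒∣ᵤ n∣x , ℤ∣.∣⇒∣ᵤ n∣y

Equivˢ-sym : ∀ {n} p q → Equivˢ n p q → Equivˢ n q p
Equivˢ-sym {n} (x , y) (x' , y') (k , (u , n∣uk-1) , n∣x , n∣y) =
  u , (k , subst (λ z → + n ∣ℤ z - 1ℤ) (ℤ.*-comm u k) n∣uk-1) ,
  ∣-combination (- u) x (inverse-combination u k x x') n∣x n∣uk-1 ,
  ∣-combination (- u) y (inverse-combination u k y y') n∣y n∣uk-1
  where
  inverse-combination : ∀ u k x x' → u * x' - x ≡ (- u) * (k * x - x') + x * (u * k - 1ℤ)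
  inverse-combination = solve-∀

Equivˢ-trans : ∀ {n} p q r → Equivˢ n p q → Equivˢ n q r → Equivˢ n p r
Equivˢ-trans {n} (x , y) (x' , y') (x'' , y'')
  (k , (u , n∣uk-1) , n∣x , n∣y) (k' , (u' , n∣u'k'-1) , n∣x' , n∣y') =
  k' * k ,
  (u' * u , ∣-combination (u' * k') 1ℤ (product-inverse u k u' k') n∣uk-1 n∣u'k'-1) ,
  ∣-combination k' 1ℤ (product-combination k k' x x' x'') n∣x n∣x' ,
  ∣-combination k' 1ℤ (product-combination k k' y y' y'') n∣y n∣y'
  where
  product-inverse : ∀ u k u' k' →
    (u' * u) * (k' * k) - 1ℤ ≡ (u' * k') * (u * k - 1ℤ) + 1ℤ * (u' * k' - 1ℤ)
  product-inverse = solve-∀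
  product-combination : ∀ k k' x x' x'' →
    (k' * k) * x - x'' ≡ k' * (k * x - x') + 1ℤ * (k' * x' - x'')
  product-combination = solve-∀

Equivˢ-weaken : ∀ {m n} p q → m ∣ n → Equivˢ n p q → Equivˢ m p q
Equivˢ-weaken {m} {n} _ _ m∣n (k , (u , n∣uk-1) , n∣x , n∣y) =
  k , (u , ℤ∣.∣-trans m∣ₛn n∣uk-1) , ℤ∣.∣-trans m∣ₛn n∣x , ℤ∣.∣-trans m∣ₛn n∣y
  where
  m∣ₛn : + m ∣ℤ + n
  m∣ₛn = ℤ∣.∣ᵤ⇒∣ m∣n

Equivˢ-act : ∀ {n} p q A → Equivˢ n p q → Equivˢ n (act p A) (act q A)
Equivˢ-act (x , y) (x' , y') (mat α γ β δ _) (k , k-unit , n∣x , n∣y) =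
  k , k-unit ,
  ∣-combination α β (linear-combination k α β x y x' y') n∣x n∣y ,
  ∣-combination γ δ (linear-combination k γ δ x y x' y') n∣x n∣y
  where
  linear-combination : ∀ k α β x y x' y' →
    k * (α * x + β * y) - (α * x' + β * y') ≡ α * (k * x - x') + β * (k * y - y')
  linear-combination = solve-∀

Equiv-refl : ∀ {n p} → Equiv n p p
Equiv-refl {n} {p@(x , y)} = Equivˢ⇒Equiv p p
  (1ℤ , (1ℤ , divides 0ℤ (vanishes 1ℤ (+ n))) ,
   divides 0ℤ (vanishes x (+ n)) , divides 0ℤ (vanishes y (+ n)))
  where
  vanishes : ∀ x m → 1ℤ * x - x ≡ 0ℤ * m
  vanishes = solve-∀

Equiv-sym : ∀ {n p q} → Equiv n p q → Equiv n q p
Equiv-sym {p = p} {q} = Equivˢ⇒Equiv q p ∘ Equivˢ-sym p q ∘ Equiv⇒Equivˢ p q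

Equiv-trans : ∀ {n p q r} → Equiv n p q → Equiv n q r → Equiv n p r
Equiv-trans {p = p} {q} {r} p∼q q∼r =
  Equivˢ⇒Equiv p r (Equivˢ-trans p q r (Equiv⇒Equivˢ p q p∼q) (Equiv⇒Equivˢ q r q∼r))

Equiv-weaken : ∀ {m n p q} → m ∣ n → Equiv n p q → Equiv m p q
Equiv-weaken {p = p} {q} m∣n = Equivˢ⇒Equiv p q ∘ Equivˢ-weaken p q m∣n ∘ Equiv⇒Equivˢ p q

Equiv-act : ∀ {n p q} A → Equiv n p q → Equiv n (act p A) (act q A)
Equiv-act {p = p} {q} A =
  Equivˢ⇒Equiv (act p A) (act q A) ∘ Equivˢ-act p q A ∘ Equiv⇒Equivˢ p q

Pair-setoid : ℕ → Setoid 0ℓ 0ℓ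
Pair-setoid n = record
  { Carrier = Pair ; _≈_ = Equiv n
  ; isEquivalence = record { refl = Equiv-refl ; sym = Equiv-sym ; trans = Equiv-trans } }

Entries : Set
Entries = ℤ × ℤ × ℤ × ℤ

entries : Mat → Entries
entries (mat a b c d _) = a , b , c , d

cong₄ : ∀ {p q r s p' q' r' s' : ℤ} → p ≡ p' → q ≡ q' → r ≡ r' → s ≡ s' →
  (p , q , r , s) ≡ (p' , q' , r' , s')
cong₄ refl refl refl refl = refl

-- entries (A · B) is definitionally entries A ⊗ entries B.
infixl 7 _⊗_
_⊗_ : Entries → Entries → Entries
(a , b , c , d) ⊗ (a' , b' , c' , d') =
  a * a' + b * c' , a * b' + b * d' , c * a' + d * c' , c * b' + d * d'

⊗-assoc : ∀ X Y Z → (X ⊗ Y) ⊗ Z ≡ X ⊗ (Y ⊗ Z)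
⊗-assoc (a , b , c , d) (a' , b' , c' , d') (a'' , b'' , c'' , d'') =
  cong₄ (row a b a' b' c' d' a'' b'' c'' d'') (row a b a' b' c' d' b'' a'' d'' c'')
        (row c d a' b' c' d' a'' b'' c'' d'') (row c d a' b' c' d' b'' a'' d'' c'')
  where
  row : ∀ a b a' b' c' d' a'' b'' c'' d'' →
    (a * a' + b * c') * a'' + (a * b' + b * d') * c''
      ≡ a * (a' * a'' + b' * c'') + b * (c' * a'' + d' * c'')
  row = solve-∀

⊗-identityʳ : ∀ X → X ⊗ entries matI ≡ X
⊗-identityʳ (a , b , c , d) = cong₄ (left a b) (right a b) (left c d) (right c d)
  where
  left : ∀ a b → a * 1ℤ + b * 0ℤ ≡ a
  left = solve-∀
  right : ∀ a b → a * 0ℤ + b * 1ℤ ≡ b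
  right = solve-∀

determinant : Mat → ℤ
determinant A = det (Mat.a A) (Mat.b A) (Mat.c A) (Mat.d A)

determinant-· : ∀ A B → determinant (A · B) ≡ determinant A * determinant B
determinant-· (mat a b c d _) (mat a' b' c' d' _) = multiplicative a b c d a' b' c' d'
  where
  multiplicative : ∀ a b c d a' b' c' d' →
    (a * a' + b * c') * (c * b' + d * d') - (a * b' + b * d') * (c * a' + d * c')
      ≡ (a * d - b * c) * (a' * d' - b' * c')
  multiplicative = solve-∀

IsGL2Z-· : ∀ {A B} → IsGL2Z A → IsGL2Z B → IsGL2Z (A · B)
IsGL2Z-· {A} {B} A-GL B-GL =
  subst (λ δ → δ ≡ 1ℤ ⊎ δ ≡ -1ℤ) (sym (determinant-· A B)) (±1-* A-GL B-GL)
  where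
  ±1-* : ∀ {x y} → x ≡ 1ℤ ⊎ x ≡ -1ℤ → y ≡ 1ℤ ⊎ y ≡ -1ℤ → x * y ≡ 1ℤ ⊎ x * y ≡ -1ℤ
  ±1-* (inj₁ refl) (inj₁ refl) = inj₁ refl
  ±1-* (inj₁ refl) (inj₂ refl) = inj₂ refl
  ±1-* (inj₂ refl) (inj₁ refl) = inj₂ refl
  ±1-* (inj₂ refl) (inj₂ refl) = inj₁ refl

act-· : ∀ p A B → act p (A · B) ≡ act (act p A) B
act-· (x , y) (mat a b c d _) (mat a' b' c' d' _) =
  cong₂ _,_ (component a b c d a' c' x y) (component a b c d b' d' x y)
  where
  component : ∀ a b c d a' c' x y →
    (a * a' + b * c') * x + (c * a' + d * c') * y ≡ a' * (a * x + c * y) + c' * (b * x + d * y)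
  component = solve-∀

act-resp-entries : ∀ p {A B} → entries A ≡ entries B → act p A ≡ act p B
act-resp-entries (x , y) {mat _ _ _ _ _} {mat _ _ _ _ _} =
  cong λ { (a , b , c , d) → a * x + c * y , b * x + d * y }

act-identity : ∀ p → act p matI ≡ p
act-identity (x , y) = cong₂ _,_ (first x y) (second x y)
  where
  first : ∀ x y → 1ℤ * x + 0ℤ * y ≡ x
  first = solve-∀
  second : ∀ x y → 0ℤ * x + 1ℤ * y ≡ y
  second = solve-∀

record GL₂ℤ : Set where
  field
    matrix inverse : Mat
    matrix-GL : IsGL2Z matrix
    inverse-GL : IsGL2Z inverse
    inverseʳ : entries (matrix · inverse) ≡ entries matI
    inverseˡ : entries (inverse · matrix) ≡ entries matI

  act-inverse : ∀ p → act (act p matrix) inverse ≡ p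
  act-inverse p = begin
    act (act p matrix) inverse  ≡⟨ act-· p matrix inverse ⟨
    act p (matrix · inverse)    ≡⟨ act-resp-entries p {matrix · inverse} {matI} inverseʳ ⟩
    act p matI                  ≡⟨ act-identity p ⟩
    p                           ∎
    where open ≡-Reasoning

_⁻¹ : GL₂ℤ → GL₂ℤ
G ⁻¹ = record
  { matrix = inverse ; inverse = matrix ; matrix-GL = inverse-GL ; inverse-GL = matrix-GL
  ; inverseʳ = inverseˡ ; inverseˡ = inverseʳ }
  where open GL₂ℤ G

InI-act : ∀ {n p} A → IsGL2Z A → InI n p → InI n (act p A)
InI-act A A-GL (g , g-GL , [0:1]g∼p) =
  g · A , IsGL2Z-· {g} {A} g-GL A-GL ,
  subst (λ q → Equiv _ q _) (sym (act-· (0ℤ , 1ℤ) g A)) (Equiv-act A [0:1]g∼p)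

InI-weaken : ∀ {m n p} → m ∣ n → InI n p → InI m p
InI-weaken m∣n (g , g-GL , [0:1]g∼p) = g , g-GL , Equiv-weaken m∣n [0:1]g∼p

InI-resp : ∀ {n p q} → Equiv n p q → InI n p → InI n q
InI-resp p∼q (g , g-GL , [0:1]g∼p) = g , g-GL , Equiv-trans [0:1]g∼p p∼q

-- does (entries? A B) is definitionally A ==M B.
entries? : ∀ A B → Dec (entries A ≡ entries B)
entries? (mat a b c d _) (mat a' b' c' d' _) =
  map′ (λ (a≡ , b≡ , c≡ , d≡) → cong₄ a≡ b≡ c≡ d≡)
       (λ e → cong proj₁ e , cong (proj₁ ∘ proj₂) e ,
              cong (proj₁ ∘ proj₂ ∘ proj₂) e , cong (proj₂ ∘ proj₂ ∘ proj₂) e)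
       (a ≟ a' ×-dec b ≟ b' ×-dec c ≟ c' ×-dec d ≟ d')

==M-resp-⇔ : ∀ A B A' B' →
  (entries A ≡ entries B ⇔ entries A' ≡ entries B') → (A ==M B) ≡ (A' ==M B')
==M-resp-⇔ A B A' B' A≅B⇔A'≅B' =
  Reflects.det (proof (map′ (Equivalence.to A≅B⇔A'≅B') (Equivalence.from A≅B⇔A'≅B') (entries? A B)))
               (proof (entries? A' B'))

·-inverse-≅ : ∀ G X Y →
  entries (X · GL₂ℤ.matrix G) ≡ entries Y → entries X ≡ entries (Y · GL₂ℤ.inverse G)
·-inverse-≅ G X Y XG≅Y = begin
  entries X                                           ≡⟨ ⊗-identityʳ _ ⟨
  entries X ⊗ entries matI                            ≡⟨ cong (entries X ⊗_) inverseʳ ⟨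
  entries X ⊗ (entries matrix ⊗ entries inverse)      ≡⟨ ⊗-assoc (entries X) (entries matrix) (entries inverse) ⟨
  (entries X ⊗ entries matrix) ⊗ entries inverse      ≡⟨ cong (_⊗ entries inverse) XG≅Y ⟩
  entries Y ⊗ entries inverse                         ∎
  where
  open GL₂ℤ G
  open ≡-Reasoning

==M-· : ∀ G B g → ((B · GL₂ℤ.matrix G) ==M g) ≡ (B ==M (g · GL₂ℤ.inverse G))
==M-· G B g = ==M-resp-⇔ (B · GL₂ℤ.matrix G) g B (g · GL₂ℤ.inverse G) (mk⇔
  (·-inverse-≅ G B g)
  (λ B≅gG⁻¹ → sym (·-inverse-≅ (G ⁻¹) g B (sym B≅gG⁻¹))))

coeff-+R : ∀ x y g → coeff (x +R y) g ≡ coeff x g + coeff y g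
coeff-+R [] y g = sym (ℤ.+-identityˡ _)
coeff-+R ((k , A) ∷ x) y g =
  trans (cong (λ z → kᵍ + z) (coeff-+R x y g)) (sym (ℤ.+-assoc kᵍ (coeff x g) (coeff y g)))
  where
  kᵍ : ℤ
  kᵍ = if A ==M g then k else 0ℤ

coeff-⋆ : ∀ k x g → coeff (k ⋆ x) g ≡ k * coeff x g
coeff-⋆ k [] g = sym (ℤ.*-zeroʳ k)
coeff-⋆ k ((k' , A) ∷ x) g =
  trans (cong₂ _+_ (scaled (A ==M g)) (coeff-⋆ k x g)) (sym (ℤ.*-distribˡ-+ k _ _))
  where
  scaled : ∀ b → (if b then k * k' else 0ℤ) ≡ k * (if b then k' else 0ℤ)
  scaled true = refl
  scaled false = sym (ℤ.*-zeroʳ k)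

coeff-*-matrix : ∀ G x g → coeff (x *R [ GL₂ℤ.matrix G ]) g ≡ coeff x (g · GL₂ℤ.inverse G)
coeff-*-matrix G [] g = refl
coeff-*-matrix G ((k , B) ∷ x) g =
  cong₂ _+_ (cong₂ (λ b k → if b then k else 0ℤ) (==M-· G B g) (ℤ.*-identityʳ k)) (coeff-*-matrix G x g)

-- _≈R_ wrapped in a record, so that both sides of an equation can be inferred from its proof.
infix 4 _≃_
record _≃_ (x y : R) : Set where
  constructor coeffwise
  field coeffs : x ≈R y
open _≃_

≃-isEquivalence : IsEquivalence _≃_
≃-isEquivalence = record
  { refl = coeffwise λ _ → refl
  ; sym = λ x≃y → coeffwise λ g → sym (coeffs x≃y g)
  ; trans = λ x≃y y≃z → coeffwise λ g → trans (coeffs x≃y g) (coeffs y≃z g) }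

≃-reflexive : ∀ {x y} → x ≡ y → x ≃ y
≃-reflexive refl = IsEquivalence.refl ≃-isEquivalence

R-commutativeMonoid : CommutativeMonoid 0ℓ 0ℓ
R-commutativeMonoid = record
  { Carrier = R ; _≈_ = _≃_ ; _∙_ = _+R_ ; ε = 0R
  ; isCommutativeMonoid = record
    { isMonoid = record
      { isSemigroup = record
        { isMagma = record
          { isEquivalence = ≃-isEquivalence
          ; ∙-cong = λ {x} {y} {u} {v} x≃y u≃v → coeffwise λ g → begin
              coeff (x +R u) g           ≡⟨ coeff-+R x u g ⟩
              coeff x g + coeff u g      ≡⟨ cong₂ _+_ (coeffs x≃y g) (coeffs u≃v g) ⟩
              coeff y g + coeff v g      ≡⟨ coeff-+R y v g ⟨
              coeff (y +R v) g           ∎ }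
        ; assoc = λ x y z → ≃-reflexive (List.++-assoc x y z) }
      ; identity = (λ _ → ≃-reflexive refl) , λ x → ≃-reflexive (List.++-identityʳ x) }
    ; comm = λ x y → coeffwise λ g → begin
        coeff (x +R y) g           ≡⟨ coeff-+R x y g ⟩
        coeff x g + coeff y g      ≡⟨ ℤ.+-comm (coeff x g) (coeff y g) ⟩
        coeff y g + coeff x g      ≡⟨ coeff-+R y x g ⟨
        coeff (y +R x) g           ∎ } }
  where open ≡-Reasoning

open CommutativeMonoid R-commutativeMonoid using (∙-cong; ∙-congˡ; ∙-congʳ) renaming (setoid to R-setoid)
module ≃-Reasoning = Relation.Binary.Reasoning.Setoid R-setoid

*R-distribʳ-+R : ∀ x y z → (x +R y) *R z ≡ (x *R z) +R (y *R z)
*R-distribʳ-+R x y z = List.concatMap-++ _ x y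

⋆-distrib-+R : ∀ k x y → k ⋆ (x +R y) ≡ (k ⋆ x) +R (k ⋆ y)
⋆-distrib-+R k x y = List.map-++ _ x y

*R-distribˡ-+R : ∀ x y z → x *R (y +R z) ≃ (x *R y) +R (x *R z)
*R-distribˡ-+R x y z = begin
  sumR (map (λ s → map (times s) (y ++ z)) x)
    ≡⟨ cong sumR (List.map-cong (λ s → List.map-++ (times s) y z) x) ⟩
  sumR (map (λ s → map (times s) y ++ map (times s) z) x)
    ≈⟨ sum-map-∙ R-commutativeMonoid (λ s → map (times s) y) (λ s → map (times s) z) x ⟩
  (x *R y) +R (x *R z)
    ∎
  where
  open ≃-Reasoning
  times : ℤ × Mat → ℤ × Mat → ℤ × Mat
  times (k , A) (k' , B) = k * k' , A · B

⋆-cong : ∀ k {x y} → x ≃ y → k ⋆ x ≃ k ⋆ y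
⋆-cong k {x} {y} x≃y = coeffwise λ g →
  trans (coeff-⋆ k x g) (trans (cong (k *_) (coeffs x≃y g)) (sym (coeff-⋆ k y g)))

*-matrix-cong : ∀ G {x y} → x ≃ y → x *R [ GL₂ℤ.matrix G ] ≃ y *R [ GL₂ℤ.matrix G ]
*-matrix-cong G {x} {y} x≃y = coeffwise λ g →
  trans (coeff-*-matrix G x g) (trans (coeffs x≃y _) (sym (coeff-*-matrix G y g)))

InIdeal-resp : ∀ {lam x y} → x ≃ y → InIdeal lam y → InIdeal lam x
InIdeal-resp x≃y (r , y≈gen*r) = r , λ g → trans (coeffs x≃y g) (y≈gen*r g)

InIdeal-+R : ∀ {lam x y} → InIdeal lam x → InIdeal lam y → InIdeal lam (x +R y)
InIdeal-+R {lam} {x} {y} (r , x≈gen*r) (r' , y≈gen*r') = r +R r' , coeffs (begin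
  x +R y                              ≈⟨ ∙-cong (coeffwise {x} {gen lam *R r} x≈gen*r)
                                                (coeffwise {y} {gen lam *R r'} y≈gen*r') ⟩
  (gen lam *R r) +R (gen lam *R r')   ≈⟨ *R-distribˡ-+R (gen lam) r r' ⟨
  gen lam *R (r +R r')                ∎)
  where open ≃-Reasoning

InIdeal-sumR : ∀ {lam xs} → All (InIdeal lam) xs → InIdeal lam (sumR xs)
InIdeal-sumR [] = [] , λ _ → refl
InIdeal-sumR {lam} {x ∷ xs} (x∈I ∷ xs∈I) =
  InIdeal-+R {lam} {x} {sumR xs} x∈I (InIdeal-sumR {lam} xs∈I)

module _ {n₁ n₂ : ℕ} where

  FibreTransversal-resp : ∀ {j j' L} → Equiv n₂ j j' →
    FibreTransversal n₁ n₂ j L → FibreTransversal n₁ n₂ j' L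
  FibreTransversal-resp j∼j' (in-fibre , unique , covers) =
    All.map (λ (i∈I , i∼j) → i∈I , Equiv-trans i∼j j∼j') in-fibre ,
    unique ,
    λ i i∈I i∼j' → covers i i∈I (Equiv-trans i∼j' (Equiv-sym j∼j'))

  FibreTransversal-act : ∀ G (f : Pair → Pair) → (∀ p → act p (GL₂ℤ.matrix G) ≡ f p) →
    ∀ {j L} → FibreTransversal n₁ n₂ j L → FibreTransversal n₁ n₂ (f j) (map f L)
  FibreTransversal-act G f act≡f {j} {L} (in-fibre , unique , covers) =
    All.map⁺ (All.map (λ (i∈I , i∼j) → InI-f i∈I , Equiv-f i∼j) in-fibre) ,
    AllPairs.map⁺ (AllPairs.map (λ i≁i' fi∼fi' → i≁i' (Equiv-f⁻¹ fi∼fi')) unique) ,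
    covers′
    where
    open GL₂ℤ G
    f⁻¹ : Pair → Pair
    f⁻¹ p = act p inverse
    f⁻¹∘f : ∀ p → f⁻¹ (f p) ≡ p
    f⁻¹∘f p = trans (cong f⁻¹ (sym (act≡f p))) (act-inverse p)
    f∘f⁻¹ : ∀ p → f (f⁻¹ p) ≡ p
    f∘f⁻¹ p = trans (sym (act≡f (f⁻¹ p))) (GL₂ℤ.act-inverse (G ⁻¹) p)
    InI-f : ∀ {n p} → InI n p → InI n (f p)
    InI-f {p = p} p∈I = subst (InI _) (act≡f p) (InI-act matrix matrix-GL p∈I)
    Equiv-f : ∀ {n p q} → Equiv n p q → Equiv n (f p) (f q)
    Equiv-f {p = p} {q} p∼q = subst₂ (Equiv _) (act≡f p) (act≡f q) (Equiv-act matrix p∼q)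
    Equiv-f⁻¹ : ∀ {n p q} → Equiv n (f p) (f q) → Equiv n p q
    Equiv-f⁻¹ {p = p} {q} fp∼fq = subst₂ (Equiv _) (f⁻¹∘f p) (f⁻¹∘f q) (Equiv-act inverse fp∼fq)
    covers′ : ∀ i → InI n₁ i → Equiv n₂ i (f j) → Any (Equiv n₁ i) (map f L)
    covers′ i i∈I i∼fj =
      Any.map⁺ (Any.map (λ f⁻¹i∼l → subst (λ q → Equiv n₁ q _) (f∘f⁻¹ i) (Equiv-f f⁻¹i∼l))
        (covers (f⁻¹ i) (InI-act inverse inverse-GL i∈I)
          (subst (Equiv n₂ (f⁻¹ i)) (f⁻¹∘f j) (Equiv-act inverse i∼fj))))

  sum-FibreTransversal : ∀ {ψ} → Respects n₁ ψ → ∀ {j L L'} →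
    FibreTransversal n₁ n₂ j L → FibreTransversal n₁ n₂ j L' → sumR (map ψ L) ≃ sumR (map ψ L')
  sum-FibreTransversal {ψ} ψ-resp {L = L} {L'}
    (in-fibre , unique , covers) (in-fibre' , unique' , covers') =
    sum-transversal R-commutativeMonoid (Pair-setoid n₁) (InI n₁) ψ
      (λ {i} {i'} i∈I i∼i' → coeffwise (ψ-resp i i' i∈I i∼i')) L L'
      (All.map proj₁ in-fibre) unique unique'
      (All.map (λ {i} (i∈I , i∼j) → covers' i i∈I i∼j) in-fibre)
      (All.map (λ {i} (i∈I , i∼j) → covers i i∈I i∼j) in-fibre')

_T⁻¹ _T⁻¹M : Pair → Pair
(c , d) T⁻¹ = c , d - c
(c , d) T⁻¹M = d - c , c

T-GL TM-GL T⁻¹M-GL : GL₂ℤ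
T-GL = record
  { matrix = matT ; inverse = mat 1ℤ -1ℤ 0ℤ 1ℤ (λ ())
  ; matrix-GL = inj₁ refl ; inverse-GL = inj₁ refl ; inverseʳ = refl ; inverseˡ = refl }
TM-GL = record
  { matrix = matT · matM ; inverse = mat 0ℤ 1ℤ 1ℤ -1ℤ (λ ())
  ; matrix-GL = inj₂ refl ; inverse-GL = inj₂ refl ; inverseʳ = refl ; inverseˡ = refl }
T⁻¹M-GL = record
  { matrix = mat -1ℤ 1ℤ 1ℤ 0ℤ (λ ()) ; inverse = mat 0ℤ 1ℤ 1ℤ 1ℤ (λ ())
  ; matrix-GL = inj₂ refl ; inverse-GL = inj₂ refl ; inverseʳ = refl ; inverseˡ = refl }

act-T⁻¹ : ∀ p → act p (GL₂ℤ.matrix (T-GL ⁻¹)) ≡ p T⁻¹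
act-T⁻¹ (c , d) = cong₂ _,_ (first c d) (second c d)
  where
  first : ∀ c d → 1ℤ * c + 0ℤ * d ≡ c
  first = solve-∀
  second : ∀ c d → -1ℤ * c + 1ℤ * d ≡ d - c
  second = solve-∀

act-T⁻¹M : ∀ p → act p (GL₂ℤ.matrix T⁻¹M-GL) ≡ p T⁻¹M
act-T⁻¹M (c , d) = cong₂ _,_ (first c d) (second c d)
  where
  first : ∀ c d → -1ℤ * c + 1ℤ * d ≡ d - c
  first = solve-∀
  second : ∀ c d → 1ℤ * c + 0ℤ * d ≡ c
  second = solve-∀

minus-·T : R → R
minus-·T x = -R (x *R [ matT ])

minus-λ·TM : ℤ → R → R
minus-λ·TM lam x = -R (lam ⋆ (x *R [ matT · matM ]))

-- Solves n lam ψ unfolds to ∀ c d → InI n (c , d) → InIdeal lam (lewis lam ψ (c , d)).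
lewis : ℤ → (Pair → R) → Pair → R
lewis lam ψ i = (ψ i +R minus-·T (ψ (i T⁻¹))) +R minus-λ·TM lam (ψ (i T⁻¹M))

minus-·T-cong : ∀ {x y} → x ≃ y → minus-·T x ≃ minus-·T y
minus-·T-cong = ⋆-cong -1ℤ ∘ *-matrix-cong T-GL

minus-λ·TM-cong : ∀ lam {x y} → x ≃ y → minus-λ·TM lam x ≃ minus-λ·TM lam y
minus-λ·TM-cong lam = ⋆-cong -1ℤ ∘ ⋆-cong lam ∘ *-matrix-cong TM-GL

minus-·T-+R : ∀ x y → minus-·T (x +R y) ≃ minus-·T x +R minus-·T y
minus-·T-+R x y = begin
  -R ((x +R y) *R [ matT ])                    ≡⟨ cong -R_ (*R-distribʳ-+R x y [ matT ]) ⟩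
  -R ((x *R [ matT ]) +R (y *R [ matT ]))      ≡⟨ ⋆-distrib-+R -1ℤ (x *R [ matT ]) (y *R [ matT ]) ⟩
  minus-·T x +R minus-·T y                     ∎
  where open ≃-Reasoning

minus-λ·TM-+R : ∀ lam x y → minus-λ·TM lam (x +R y) ≃ minus-λ·TM lam x +R minus-λ·TM lam y
minus-λ·TM-+R lam x y = begin
  -R (lam ⋆ ((x +R y) *R [ TM ]))
    ≡⟨ cong (λ z → -R (lam ⋆ z)) (*R-distribʳ-+R x y [ TM ]) ⟩
  -R (lam ⋆ (xTM +R yTM))
    ≡⟨ cong -R_ (⋆-distrib-+R lam xTM yTM) ⟩
  -R ((lam ⋆ xTM) +R (lam ⋆ yTM))
    ≡⟨ ⋆-distrib-+R -1ℤ (lam ⋆ xTM) (lam ⋆ yTM) ⟩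
  minus-λ·TM lam x +R minus-λ·TM lam y
    ∎
  where
  open ≃-Reasoning
  TM : Mat
  TM = matT · matM
  xTM yTM : R
  xTM = x *R [ TM ]
  yTM = y *R [ TM ]

sum-lewis : ∀ lam ψ L → sumR (map (lewis lam ψ) L) ≃
  (sumR (map ψ L) +R minus-·T (sumR (map (ψ ∘ _T⁻¹) L))) +R minus-λ·TM lam (sumR (map (ψ ∘ _T⁻¹M) L))
sum-lewis lam ψ L = begin
  Σ (lewis lam ψ)
    ≈⟨ sum-map-∙ R-commutativeMonoid (λ i → ψ i +R ψT⁻¹ i) ψT⁻¹M L ⟩
  Σ (λ i → ψ i +R ψT⁻¹ i) +R Σ ψT⁻¹M
    ≈⟨ ∙-cong (sum-map-∙ R-commutativeMonoid ψ ψT⁻¹ L)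
              (sum-map-homomorphic R-commutativeMonoid (minus-λ·TM lam) (≃-reflexive refl)
                                   (minus-λ·TM-+R lam) (ψ ∘ _T⁻¹M) L) ⟩
  (Σ ψ +R Σ ψT⁻¹) +R minus-λ·TM lam (Σ (ψ ∘ _T⁻¹M))
    ≈⟨ ∙-congʳ {minus-λ·TM lam (Σ (ψ ∘ _T⁻¹M))} (∙-congˡ {Σ ψ}
         (sum-map-homomorphic R-commutativeMonoid minus-·T (≃-reflexive refl) minus-·T-+R (ψ ∘ _T⁻¹) L)) ⟩
  (Σ ψ +R minus-·T (Σ (ψ ∘ _T⁻¹))) +R minus-λ·TM lam (Σ (ψ ∘ _T⁻¹M))
    ∎
  where
  open ≃-Reasoning
  Σ : (Pair → R) → R
  Σ φ = sumR (map φ L)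
  ψT⁻¹ ψT⁻¹M : Pair → R
  ψT⁻¹ = minus-·T ∘ ψ ∘ _T⁻¹
  ψT⁻¹M = minus-λ·TM lam ∘ ψ ∘ _T⁻¹M

module Pushforward {n₁ n₂ : ℕ} {ψ : Pair → R} (ψ-resp : Respects n₁ ψ)
  {L : Pair → List Pair} (L-transversal : ∀ j → InI n₂ j → FibreTransversal n₁ n₂ j (L j)) where

  open ≃-Reasoning

  Σψ : Pair → R
  Σψ j = sumR (map ψ (L j))

  respects : Respects n₂ Σψ
  respects j j' j∈I j∼j' = coeffs (sum-FibreTransversal ψ-resp
    (FibreTransversal-resp j∼j' (L-transversal j j∈I)) (L-transversal j' (InI-resp j∼j' j∈I)))

  sum-shift : ∀ G (f : Pair → Pair) → (∀ p → act p (GL₂ℤ.matrix G) ≡ f p) →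
    ∀ {j} → InI n₂ j → Σψ (f j) ≃ sumR (map (ψ ∘ f) (L j))
  sum-shift G f act≡f {j} j∈I = begin
    sumR (map ψ (L (f j)))        ≈⟨ sum-FibreTransversal ψ-resp (L-transversal (f j) fj∈I)
                                       (FibreTransversal-act G f act≡f (L-transversal j j∈I)) ⟩
    sumR (map ψ (map f (L j)))    ≡⟨ cong sumR (List.map-∘ (L j)) ⟨
    sumR (map (ψ ∘ f) (L j))      ∎
    where
    fj∈I : InI n₂ (f j)
    fj∈I = subst (InI n₂) (act≡f j) (InI-act (GL₂ℤ.matrix G) (GL₂ℤ.matrix-GL G) j∈I)

  lewis-Σψ : ∀ lam {j} → InI n₂ j → lewis lam Σψ j ≃ sumR (map (lewis lam ψ) (L j))
  lewis-Σψ lam {j} j∈I = begin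
    (Σψ j +R minus-·T (Σψ (j T⁻¹))) +R minus-λ·TM lam (Σψ (j T⁻¹M))
      ≈⟨ ∙-cong (∙-congˡ {Σψ j} (minus-·T-cong (sum-shift (T-GL ⁻¹) _T⁻¹ act-T⁻¹ j∈I)))
                (minus-λ·TM-cong lam (sum-shift T⁻¹M-GL _T⁻¹M act-T⁻¹M j∈I)) ⟩
    (Σψ j +R minus-·T (sumR (map (ψ ∘ _T⁻¹) (L j))))
      +R minus-λ·TM lam (sumR (map (ψ ∘ _T⁻¹M) (L j)))
      ≈⟨ sum-lewis lam ψ (L j) ⟨
    sumR (map (lewis lam ψ) (L j))
      ∎

  solves : ∀ {lam} → Solves n₁ lam ψ → Solves n₂ lam Σψ
  solves {lam} ψ-solves c d j∈I = InIdeal-resp {lam} (lewis-Σψ lam j∈I) (InIdeal-sumR {lam}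
    (All.map⁺ (All.map (λ {i} (i∈I , _) → ψ-solves (proj₁ i) (proj₂ i) i∈I)
                       (proj₁ (L-transversal (c , d) j∈I)))))

module Pullback {m n : ℕ} (m∣n : m ∣ n) {ψ : Pair → R} where

  respects : Respects m ψ → Respects n ψ
  respects ψ-resp i i' i∈I i∼i' = ψ-resp i i' (InI-weaken m∣n i∈I) (Equiv-weaken m∣n i∼i')

  solves : ∀ {lam} → Solves m lam ψ → Solves n lam ψ
  solves ψ-solves c d i∈I = ψ-solves c d (InI-weaken m∣n i∈I)

proposition8p3 : (n₁ n₂ : ℕ) → 1 ≤ n₁ → 1 ≤ n₂ → n₂ ∣ n₁ →
    (lam : ℤ) → lam ≡ 1ℤ ⊎ lam ≡ -1ℤ →
    ((ψ¹ : Pair → R) → Respects n₁ ψ¹ → Solves n₁ lam ψ¹ →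
      (L : Pair → List Pair) → (∀ j → InI n₂ j → FibreTransversal n₁ n₂ j (L j)) →
      Respects n₂ (λ j → sumR (map ψ¹ (L j))) × Solves n₂ lam (λ j → sumR (map ψ¹ (L j))))
    ×
    ((ψ² : Pair → R) → Respects n₂ ψ² → Solves n₂ lam ψ² →
      Respects n₁ (λ i → ψ² (σ i)) × Solves n₁ lam (λ i → ψ² (σ i)))
proposition8p3 n₁ n₂ _ _ n₂∣n₁ lam _ =
  (λ ψ¹ ψ¹-resp ψ¹-solves L L-transversal →
     let open Pushforward {ψ = ψ¹} ψ¹-resp L-transversal in respects , solves {lam} ψ¹-solves) ,
  (λ ψ² ψ²-resp ψ²-solves →
     let open Pullback n₂∣n₁ {ψ²} in respects ψ²-resp , solves {lam} ψ²-solves)
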